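{- Let $H\le S_4$ be a Cayley integral subgroup of the symmetric group $S_4$ that acts transitively on $\{1,2,3,4\}$. Then $|H|=4$.
   Context: For a group $G$ and a symmetric subset $S\subseteq G$ ($S=S^{ -1}$), the Cayley graph $\mathrm{Cay}(G,S)$ has vertex set $G$ and adjacency matrix $A$ with $A_{x,y}=1$ iff $xy^{ -1}\in S$. A graph is integral if all eigenvalues of its adjacency matrix are integers. A group $G$ is Cayley integral if $\mathrm{Cay}(G,S)$ is integral for every symmetric subset $S$ of $G$. -}

module Defs where

open import Data.Nat using (ℕ; zero; suc)
open import Data.Bool using (Bool; true; false; if_then_else_; T)
open import Data.Fin using (Fin; zero; suc; punchIn; _≟_)
open import Data.Fin.Properties using (any?)
open import Data.Integer using (ℤ; +_; _+_; _*_; _-_; -_)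
open import Data.Vec using (Vec; lookup; map; tabulate)
open import Data.Vec.Properties using (≡-dec)
open import Data.List using (List; length)
import Data.List as L
open import Data.List.Membership.Propositional using (_∈_)
open import Data.List.Relation.Unary.Unique.Propositional using (Unique)
open import Data.Product using (Σ; _×_; _,_; ∃-syntax)
open import Relation.Nullary using (Dec; does; yes; no)
open import Relation.Nullary.Decidable using (_×-dec_)
open import Relation.Binary.PropositionalEquality using (_≡_)

Σℤ : ∀ {n} → (Fin n → ℤ) → ℤ
Σℤ {zero}  f = + 0
Σℤ {suc n} f = f zero + Σℤ (λ i → f (suc i))

Πℤ : ∀ {n} → (Fin n → ℤ) → ℤ
Πℤ {zero}  f = + 1
Πℤ {suc n} f = f zero * Πℤ (λ i → f (suc i))

Matrix : ℕ → Set
Matrix n = Fin n → Fin n → ℤ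

sign : ∀ {n} → Fin n → ℤ
sign zero          = + 1
sign (suc zero)    = - (+ 1)
sign (suc (suc i)) = sign i

det : ∀ {n} → Matrix n → ℤ
det {zero}  M = + 1
det {suc n} M =
  Σℤ (λ j → sign j * (M zero j * det (λ r c → M (suc r) (punchIn j c))))

δ : ∀ {n} → Fin n → Fin n → ℤ
δ i j = if does (i ≟ j) then + 1 else + 0

charPolyAt : ∀ {n} → Matrix n → ℤ → ℤ
charPolyAt A t = det (λ i j → (t * δ i j) - A i j)

-- A (symmetric integer) matrix is integral: all its eigenvalues (the roots,
-- with multiplicity, of the characteristic polynomial) are integers, i.e.
-- the characteristic polynomial is ∏ (x - λᵢ) for integers λ₁..λₙ.
-- (Two polynomials agree iff they agree at every integer point.)
IsIntegralMatrix : ∀ {n} → Matrix n → Set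
IsIntegralMatrix {n} A =
  Σ (Fin n → ℤ) λ lam → ∀ (t : ℤ) → charPolyAt A t ≡ Πℤ (λ i → t - lam i)

-- The symmetric group S₄, elements as image vectors: σ(i) = lookup σ i

Perm4 : Set
Perm4 = Vec (Fin 4) 4

idP : Perm4
idP = tabulate (λ i → i)

_∘P_ : Perm4 → Perm4 → Perm4
σ ∘P τ = map (lookup σ) τ

_≟P_ : (σ τ : Perm4) → Dec (σ ≡ τ)
_≟P_ = ≡-dec _≟_

IsPerm : Perm4 → Set
IsPerm σ = ∀ i j → lookup σ i ≡ lookup σ j → i ≡ j

record Subgroup (H : List Perm4) : Set where
  field
    unique  : Unique H
    perms   : ∀ {σ} → σ ∈ H → IsPerm σ
    hasId   : idP ∈ H
    closed  : ∀ {σ τ} → σ ∈ H → τ ∈ H → (σ ∘P τ) ∈ H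
    hasInv  : ∀ {σ} → σ ∈ H → ∃[ τ ] (τ ∈ H × (τ ∘P σ ≡ idP) × (σ ∘P τ ≡ idP))

Transitive : List Perm4 → Set
Transitive H = ∀ (a b : Fin 4) → ∃[ σ ] (σ ∈ H × lookup σ a ≡ b)

elt : (H : List Perm4) → Fin (length H) → Perm4
elt H = L.lookup H

-- a subset S ⊆ H is given by its indicator on positions;
-- symmetric: S = S⁻¹
Symmetric : (H : List Perm4) → (Fin (length H) → Bool) → Set
Symmetric H S = ∀ l → T (S l) →
  ∃[ l' ] (T (S l') × (elt H l' ∘P elt H l ≡ idP))

-- adjacency: A x y = 1 iff x y⁻¹ ∈ S, i.e. iff x = s y for some s ∈ S
cayleyAdj : (H : List Perm4) → (Fin (length H) → Bool) → Matrix (length H)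
cayleyAdj H S x y =
  if does (any? (λ l → T? (S l) ×-dec (elt H x ≟P (elt H l ∘P elt H y))))
  then + 1 else + 0
  where
  T? : (b : Bool) → Dec (T b)
  T? true  = yes _
  T? false = no (λ ())

CayleyIntegral : List Perm4 → Set
CayleyIntegral H = ∀ (S : Fin (length H) → Bool) → Symmetric H S →
  IsIntegralMatrix (cayleyAdj H S)

module Submission where

open import Defs
open import Data.List using (List; length)
open import Relation.Binary.PropositionalEquality using (_≡_)

-- If Cay(H, S) is integral, its characteristic polynomial p is ∏ (t − λᵢ) with integers λᵢ; as one of
-- a − λᵢ, a + 1 − λᵢ, a + 2 − λᵢ is divisible by 3, 3^|H| divides p(a) p(a+1) p(a+2). For the three
-- dihedral subgroups D₄, for A₄ and for S₄ a symmetric S and an integer a violating this are exhibited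
-- by evaluating determinants (for S₄ blockwise over the cosets of D₄); since H may list its elements
-- in any order, this relies on the invariance of det under simultaneous permutation of rows and columns.
-- A transitive H contains elements sending 0 to 1, 2 and 3. Computing generated subgroups shows that
-- these generate a group containing D₄, A₄, a cyclic group of order 4 or the Klein four-group; that
-- such a group of order 4 together with any other element generates a group containing D₄ or A₄; and
-- that D₄ or A₄ together with any other element generates S₄.

module Sums where

  open import Data.Nat using (zero; suc) renaming (_+_ to _+ℕ_)
  open import Data.Fin using (Fin; zero; suc; punchIn; _↑ˡ_; _↑ʳ_; _≟_)
  open import Data.Integer using (ℤ; +_; _+_; _*_; -_)
  open import Data.Integer.Properties
    using (neg-distrib-+; *-distribˡ-+; *-distribʳ-+; *-zeroʳ; +-identityˡ; +-assoc; +-commutativeSemigroup)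
  open import Algebra.Properties.CommutativeSemigroup +-commutativeSemigroup using (interchange; x∙yz≈y∙xz)
  open import Data.Fin.Properties using (punchInᵢ≢i)
  open import Data.Bool using (if_then_else_)
  open import Function using (_∘_)
  open import Relation.Nullary using (does)
  open import Relation.Nullary.Decidable using (dec-true; dec-false)
  open import Relation.Binary.PropositionalEquality using (_≡_; refl; sym; trans; cong; cong₂; module ≡-Reasoning)
  open ≡-Reasoning

  Σℤ-cong : ∀ {n} {f g : Fin n → ℤ} → (∀ i → f i ≡ g i) → Σℤ f ≡ Σℤ g
  Σℤ-cong {zero}  e = refl
  Σℤ-cong {suc n} e = cong₂ _+_ (e zero) (Σℤ-cong (λ i → e (suc i)))

  Σℤ-vanish : ∀ {n} (f : Fin n → ℤ) → (∀ i → f i ≡ + 0) → Σℤ f ≡ + 0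
  Σℤ-vanish {zero}  f e = refl
  Σℤ-vanish {suc n} f e = cong₂ _+_ (e zero) (Σℤ-vanish (λ i → f (suc i)) (λ i → e (suc i)))

  Σℤ-neg : ∀ {n} (f : Fin n → ℤ) → Σℤ (λ i → - f i) ≡ - Σℤ f
  Σℤ-neg {zero}  f = refl
  Σℤ-neg {suc n} f =
    trans (cong (λ s → - f zero + s) (Σℤ-neg (λ i → f (suc i)))) (sym (neg-distrib-+ (f zero) _))

  Σℤ-*ˡ : ∀ {n} (c : ℤ) (f : Fin n → ℤ) → Σℤ (λ i → c * f i) ≡ c * Σℤ f
  Σℤ-*ˡ {zero}  c f = sym (*-zeroʳ c)
  Σℤ-*ˡ {suc n} c f =
    trans (cong (λ s → c * f zero + s) (Σℤ-*ˡ c (λ i → f (suc i)))) (sym (*-distribˡ-+ c (f zero) _))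

  Σℤ-*ʳ : ∀ {n} (c : ℤ) (f : Fin n → ℤ) → Σℤ (λ i → f i * c) ≡ Σℤ f * c
  Σℤ-*ʳ {zero}  c f = refl
  Σℤ-*ʳ {suc n} c f =
    trans (cong (λ s → f zero * c + s) (Σℤ-*ʳ c (λ i → f (suc i)))) (sym (*-distribʳ-+ c (f zero) _))

  Σℤ-+ : ∀ {n} (f g : Fin n → ℤ) → Σℤ (λ i → f i + g i) ≡ Σℤ f + Σℤ g
  Σℤ-+ {zero}  f g = refl
  Σℤ-+ {suc n} f g =
    trans (cong (λ s → f zero + g zero + s) (Σℤ-+ (λ i → f (suc i)) (λ i → g (suc i))))
          (interchange (f zero) (g zero) _ _)

  Σℤ-swap : ∀ {m n} (f : Fin m → Fin n → ℤ) →
    Σℤ (λ i → Σℤ (λ j → f i j)) ≡ Σℤ (λ j → Σℤ (λ i → f i j))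
  Σℤ-swap {zero}  f = sym (Σℤ-vanish (λ j → Σℤ (λ i → f i j)) (λ _ → refl))
  Σℤ-swap {suc m} f =
    trans (cong (λ s → Σℤ (f zero) + s) (Σℤ-swap (λ i j → f (suc i) j)))
          (sym (Σℤ-+ (f zero) (λ j → Σℤ (λ i → f (suc i) j))))

  Σℤ-punchIn : ∀ {n} (k : Fin (suc n)) (f : Fin (suc n) → ℤ) →
    Σℤ f ≡ f k + Σℤ (λ c → f (punchIn k c))
  Σℤ-punchIn zero    f = refl
  Σℤ-punchIn {suc n} (suc k) f =
    trans (cong (λ s → f zero + s) (Σℤ-punchIn k (λ i → f (suc i))))
          (x∙yz≈y∙xz (f zero) (f (suc k)) _)

  Σℤ-↑ : ∀ m {n} (f : Fin (m +ℕ n) → ℤ) →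
    Σℤ f ≡ Σℤ (λ i → f (i ↑ˡ n)) + Σℤ (λ i → f (m ↑ʳ i))
  Σℤ-↑ zero    f = sym (+-identityˡ (Σℤ f))
  Σℤ-↑ (suc m) f =
    trans (cong (λ s → f zero + s) (Σℤ-↑ m (λ i → f (suc i))))
          (sym (+-assoc (f zero) _ _))

  Σℤ-punchIn-omit : ∀ {m} (j : Fin (suc (suc m))) (f : Fin (suc (suc m)) → ℤ) →
    Σℤ (λ c → f (punchIn j c)) ≡ Σℤ (λ k → if does (j ≟ k) then + 0 else f k)
  Σℤ-punchIn-omit {m} j f = sym (begin
    Σℤ g
      ≡⟨ Σℤ-punchIn j g ⟩
    g j + Σℤ (λ c → g (punchIn j c))
      ≡⟨ cong (λ b → (if b then + 0 else f j) + Σℤ (λ c → g (punchIn j c))) (dec-true (j ≟ j) refl) ⟩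
    + 0 + Σℤ (λ c → g (punchIn j c))
      ≡⟨ cong (λ s → + 0 + s) (Σℤ-cong (λ c → cong (λ b → if b then + 0 else f (punchIn j c))
                                                    (dec-false (j ≟ punchIn j c) (punchInᵢ≢i j c ∘ sym)))) ⟩
    + 0 + Σℤ (λ c → f (punchIn j c))
      ≡⟨ +-identityˡ _ ⟩
    Σℤ (λ c → f (punchIn j c)) ∎)
    where
    g : Fin (suc (suc m)) → ℤ
    g k = if does (j ≟ k) then + 0 else f k

module Determinant where

  open Sums
  open import Data.Nat using (zero; suc) renaming (_+_ to _+ℕ_)
  open import Data.Fin using (Fin; zero; suc; punchIn; punchOut; inject₁; _↑ˡ_; _↑ʳ_; _≟_)
  open import Data.Fin.Properties using (suc-injective; punchOut-injective; punchIn-punchOut)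
  open import Data.Integer using (ℤ; +_; _+_; _*_; -_)
  open import Data.Integer.Properties
    using (neg-involutive; neg-distribˡ-*; +-identityʳ; *-identityˡ; *-zeroʳ; +-commutativeSemigroup)
  open import Algebra.Properties.CommutativeSemigroup +-commutativeSemigroup using (x∙yz≈y∙xz)
  open import Data.Integer.Tactic.RingSolver using (solve-∀)
  open import Data.Bool using (if_then_else_)
  open import Data.List using (List; []; _∷_; _++_; map)
  open import Data.Product using (Σ; _,_; proj₁; proj₂)
  open import Data.Empty using (⊥-elim)
  open import Function using (_∘_)
  open import Function.Definitions using (Injective)
  open import Relation.Nullary using (¬_; does; yes; no)
  open import Relation.Binary.PropositionalEquality
  open ≡-Reasoning

  minor : ∀ {n} → Matrix (suc n) → Fin (suc n) → Matrix n
  minor M j r c = M (suc r) (punchIn j c)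

  laplaceTerm : ∀ {n} → Matrix (suc n) → Fin (suc n) → ℤ
  laplaceTerm M j = sign j * (M zero j * det (minor M j))

  det-cong : ∀ {n} {M N : Matrix n} → (∀ i j → M i j ≡ N i j) → det M ≡ det N
  det-cong {zero}  e = refl
  det-cong {suc n} e = Σℤ-cong λ j →
    cong₂ (λ a b → sign j * (a * b)) (e zero j) (det-cong (λ r c → e (suc r) (punchIn j c)))

  sign-suc : ∀ {n} (i : Fin n) → sign (suc i) ≡ - sign i
  sign-suc zero    = refl
  sign-suc (suc i) = trans (sym (neg-involutive (sign i))) (cong -_ (sym (sign-suc i)))

  sign-inject₁ : ∀ {n} (i : Fin n) → sign (inject₁ i) ≡ sign i
  sign-inject₁ zero          = refl
  sign-inject₁ (suc zero)    = refl
  sign-inject₁ (suc (suc i)) = sign-inject₁ i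

  sign-suc-inject₁ : ∀ {n} (i : Fin n) → sign (suc i) ≡ - sign (inject₁ i)
  sign-suc-inject₁ i = trans (sign-suc i) (cong -_ (sym (sign-inject₁ i)))

  sign-inject₁-suc : ∀ {n} (i : Fin n) → sign (inject₁ i) ≡ - sign (suc i)
  sign-inject₁-suc i = trans (sym (neg-involutive (sign (inject₁ i)))) (cong -_ (sym (sign-suc-inject₁ i)))

  -- Swapping the first two rows

  -- A total punchOut: the position of k once j has been removed (junk at k = j).
  punchOut′ : ∀ {m} → Fin (suc (suc m)) → Fin (suc (suc m)) → Fin (suc m)
  punchOut′ zero    zero    = zero
  punchOut′ zero    (suc k) = k
  punchOut′ (suc j) zero    = zero
  punchOut′ {zero}  (suc j) (suc k) = zero
  punchOut′ {suc m} (suc j) (suc k) = suc (punchOut′ j k)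

  punchOut′-punchIn : ∀ {m} (j : Fin (suc (suc m))) (c : Fin (suc m)) → punchOut′ j (punchIn j c) ≡ c
  punchOut′-punchIn zero    c       = refl
  punchOut′-punchIn (suc j) zero    = refl
  punchOut′-punchIn {suc m} (suc j) (suc c) = cong suc (punchOut′-punchIn j c)

  punchIn-punchOut′-comm : ∀ {m} (j k : Fin (suc (suc m))) → ¬ j ≡ k → ∀ d →
    punchIn j (punchIn (punchOut′ j k) d) ≡ punchIn k (punchIn (punchOut′ k j) d)
  punchIn-punchOut′-comm zero    zero    j≢k d = ⊥-elim (j≢k refl)
  punchIn-punchOut′-comm zero    (suc k) j≢k d = refl
  punchIn-punchOut′-comm (suc j) zero    j≢k d = refl
  punchIn-punchOut′-comm {zero}  (suc zero) (suc zero) j≢k d = ⊥-elim (j≢k refl)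
  punchIn-punchOut′-comm {suc m} (suc j) (suc k) j≢k zero    = refl
  punchIn-punchOut′-comm {suc m} (suc j) (suc k) j≢k (suc d) =
    cong suc (punchIn-punchOut′-comm j k (j≢k ∘ cong suc) d)

  sign-punchOut′-antisym : ∀ {m} (j k : Fin (suc (suc m))) → ¬ j ≡ k →
    sign j * sign (punchOut′ j k) ≡ - (sign k * sign (punchOut′ k j))
  sign-punchOut′-antisym zero    zero    j≢k = ⊥-elim (j≢k refl)
  sign-punchOut′-antisym zero    (suc k) j≢k = begin
    + 1 * sign k               ≡⟨ lemma (sign k) ⟩
    - (- sign k * + 1)         ≡⟨ cong (λ s → - (s * + 1)) (sym (sign-suc k)) ⟩
    - (sign (suc k) * + 1)     ∎
    where
    lemma : ∀ a → + 1 * a ≡ - (- a * + 1)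
    lemma = solve-∀
  sign-punchOut′-antisym (suc j) zero    j≢k = begin
    sign (suc j) * + 1         ≡⟨ cong (_* + 1) (sign-suc j) ⟩
    - sign j * + 1             ≡⟨ lemma (sign j) ⟩
    - (+ 1 * sign j)           ∎
    where
    lemma : ∀ a → - a * + 1 ≡ - (+ 1 * a)
    lemma = solve-∀
  sign-punchOut′-antisym {zero}  (suc zero) (suc zero) j≢k = ⊥-elim (j≢k refl)
  sign-punchOut′-antisym {suc m} (suc j) (suc k) j≢k = begin
    sign (suc j) * sign (suc (punchOut′ j k))    ≡⟨ cong₂ _*_ (sign-suc j) (sign-suc (punchOut′ j k)) ⟩
    - sign j * - sign (punchOut′ j k)            ≡⟨ lemma (sign j) _ ⟩
    sign j * sign (punchOut′ j k)                ≡⟨ sign-punchOut′-antisym j k (j≢k ∘ cong suc) ⟩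
    - (sign k * sign (punchOut′ k j))            ≡⟨ cong -_ (sym (lemma (sign k) _)) ⟩
    - (- sign k * - sign (punchOut′ k j))        ≡˘⟨ cong -_ (cong₂ _*_ (sign-suc k) (sign-suc (punchOut′ k j))) ⟩
    - (sign (suc k) * sign (suc (punchOut′ k j))) ∎
    where
    lemma : ∀ a b → - a * - b ≡ a * b
    lemma = solve-∀

  twoRowTerm : ∀ {n} → Matrix (suc (suc n)) → Fin (suc (suc n)) → Fin (suc (suc n)) → ℤ
  twoRowTerm M j k = if does (j ≟ k) then + 0 else
    sign j * (M zero j * (sign (punchOut′ j k) * (M (suc zero) k *
      det (λ r d → M (suc (suc r)) (punchIn j (punchIn (punchOut′ j k) d))))))

  det-expand₂ : ∀ {n} (M : Matrix (suc (suc n))) → det M ≡ Σℤ (λ j → Σℤ (λ k → twoRowTerm M j k))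
  det-expand₂ {n} M = Σℤ-cong λ j → begin
    sign j * (M zero j * Σℤ (λ c → term j c))
      ≡⟨ cong (sign j *_) (sym (Σℤ-*ˡ (M zero j) (term j))) ⟩
    sign j * Σℤ (λ c → M zero j * term j c)
      ≡⟨ sym (Σℤ-*ˡ (sign j) (λ c → M zero j * term j c)) ⟩
    Σℤ (λ c → sign j * (M zero j * term j c))
      ≡⟨ Σℤ-cong (λ c → cong (λ c′ → pairTerm j c′ (punchIn j c)) (sym (punchOut′-punchIn j c))) ⟩
    Σℤ (λ c → pairTerm j (punchOut′ j (punchIn j c)) (punchIn j c))
      ≡⟨ Σℤ-punchIn-omit j (λ k → pairTerm j (punchOut′ j k) k) ⟩
    Σℤ (λ k → twoRowTerm M j k) ∎
    where
    term : _ → _ → ℤ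
    term j c = sign c * (M (suc zero) (punchIn j c) * det (λ r d → M (suc (suc r)) (punchIn j (punchIn c d))))
    pairTerm : _ → _ → _ → ℤ
    pairTerm j c k = sign j * (M zero j * (sign c * (M (suc zero) k *
      det (λ r d → M (suc (suc r)) (punchIn j (punchIn c d))))))

  swap₀₁ : ∀ {n} → Fin (suc (suc n)) → Fin (suc (suc n))
  swap₀₁ zero          = suc zero
  swap₀₁ (suc zero)    = zero
  swap₀₁ (suc (suc i)) = suc (suc i)

  twoRowTerm-swap₀₁ : ∀ {n} (M : Matrix (suc (suc n))) j k →
    twoRowTerm (M ∘ swap₀₁) j k ≡ - twoRowTerm M k j
  twoRowTerm-swap₀₁ {n} M j k with j ≟ k | k ≟ j
  ... | yes _   | yes _ = refl
  ... | yes j≡k | no k≢j = ⊥-elim (k≢j (sym j≡k))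
  ... | no j≢k  | yes k≡j = ⊥-elim (j≢k (sym k≡j))
  ... | no j≢k  | no _ = begin
    a * (x * (b * (y * D j k)))     ≡⟨ cong (λ z → a * (x * (b * (y * z)))) (det-cong (λ r d →
                                         cong (M (suc (suc r))) (punchIn-punchOut′-comm j k j≢k d))) ⟩
    a * (x * (b * (y * D k j)))     ≡⟨ lemma a b (sign k) (sign (punchOut′ k j)) x y (D k j)
                                         (sign-punchOut′-antisym j k j≢k) ⟩
    - (sign k * (y * (sign (punchOut′ k j) * (x * D k j)))) ∎
    where
    a = sign j
    b = sign (punchOut′ j k)
    x = M (suc zero) j
    y = M zero k
    D : _ → _ → ℤ
    D j k = det (λ r d → M (suc (suc r)) (punchIn j (punchIn (punchOut′ j k) d)))
    lemma : ∀ a b c d x y z → a * b ≡ - (c * d) → a * (x * (b * (y * z))) ≡ - (c * (y * (d * (x * z))))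
    lemma a b c d x y z ab≡-cd =
      trans (regroup a b x y z) (trans (cong (_* (x * (y * z))) ab≡-cd) (regroup′ c d x y z))
      where
      regroup : ∀ a b x y z → a * (x * (b * (y * z))) ≡ (a * b) * (x * (y * z))
      regroup = solve-∀
      regroup′ : ∀ c d x y z → - (c * d) * (x * (y * z)) ≡ - (c * (y * (d * (x * z))))
      regroup′ = solve-∀

  det-swap₀₁ : ∀ {n} (M : Matrix (suc (suc n))) → det (M ∘ swap₀₁) ≡ - det M
  det-swap₀₁ M = begin
    det (M ∘ swap₀₁)
      ≡⟨ det-expand₂ (M ∘ swap₀₁) ⟩
    Σℤ (λ j → Σℤ (λ k → twoRowTerm (M ∘ swap₀₁) j k))
      ≡⟨ Σℤ-swap (twoRowTerm (M ∘ swap₀₁)) ⟩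
    Σℤ (λ k → Σℤ (λ j → twoRowTerm (M ∘ swap₀₁) j k))
      ≡⟨ Σℤ-cong (λ k → Σℤ-cong (λ j → twoRowTerm-swap₀₁ M j k)) ⟩
    Σℤ (λ k → Σℤ (λ j → - twoRowTerm M k j))
      ≡⟨ Σℤ-cong (λ k → Σℤ-neg (twoRowTerm M k)) ⟩
    Σℤ (λ k → - Σℤ (λ j → twoRowTerm M k j))
      ≡⟨ Σℤ-neg (λ k → Σℤ (twoRowTerm M k)) ⟩
    - Σℤ (λ k → Σℤ (λ j → twoRowTerm M k j))
      ≡˘⟨ cong -_ (det-expand₂ M) ⟩
    - det M ∎

  adjacentSwap : ∀ {n} → Fin n → Fin (suc n) → Fin (suc n)
  adjacentSwap zero    i       = swap₀₁ i
  adjacentSwap (suc k) zero    = zero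
  adjacentSwap (suc k) (suc i) = suc (adjacentSwap k i)

  adjacentSwap-inject₁ : ∀ {n} (k : Fin n) → adjacentSwap k (inject₁ k) ≡ suc k
  adjacentSwap-inject₁ zero    = refl
  adjacentSwap-inject₁ (suc k) = cong suc (adjacentSwap-inject₁ k)

  adjacentSwap-suc : ∀ {n} (k : Fin n) → adjacentSwap k (suc k) ≡ inject₁ k
  adjacentSwap-suc zero    = refl
  adjacentSwap-suc (suc k) = cong suc (adjacentSwap-suc k)

  adjacentSwap-punchIn-suc : ∀ {n} (k c : Fin n) → adjacentSwap k (punchIn (suc k) c) ≡ punchIn (inject₁ k) c
  adjacentSwap-punchIn-suc zero    zero    = refl
  adjacentSwap-punchIn-suc zero    (suc c) = refl
  adjacentSwap-punchIn-suc (suc k) zero    = refl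
  adjacentSwap-punchIn-suc (suc k) (suc c) = cong suc (adjacentSwap-punchIn-suc k c)

  adjacentSwap-punchIn-inject₁ : ∀ {n} (k c : Fin n) → adjacentSwap k (punchIn (inject₁ k) c) ≡ punchIn (suc k) c
  adjacentSwap-punchIn-inject₁ zero    zero    = refl
  adjacentSwap-punchIn-inject₁ zero    (suc c) = refl
  adjacentSwap-punchIn-inject₁ (suc k) zero    = refl
  adjacentSwap-punchIn-inject₁ (suc k) (suc c) = cong suc (adjacentSwap-punchIn-inject₁ k c)

  adjacentSwap-fixes : ∀ {n} (k : Fin n) (j : Fin (suc n)) → ¬ j ≡ inject₁ k → ¬ j ≡ suc k →
    adjacentSwap k j ≡ j
  adjacentSwap-fixes zero    zero             j≢k _     = ⊥-elim (j≢k refl)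
  adjacentSwap-fixes zero    (suc zero)       _   j≢k+1 = ⊥-elim (j≢k+1 refl)
  adjacentSwap-fixes zero    (suc (suc j))    _   _     = refl
  adjacentSwap-fixes (suc k) zero             _   _     = refl
  adjacentSwap-fixes (suc k) (suc j)          j≢k j≢k+1 =
    cong suc (adjacentSwap-fixes k j (j≢k ∘ cong suc) (j≢k+1 ∘ cong suc))

  adjacentSwap-punchIn : ∀ {m} (k : Fin (suc m)) (j : Fin (suc (suc m))) → ¬ j ≡ inject₁ k → ¬ j ≡ suc k →
    Σ (Fin m) λ k′ → ∀ c → adjacentSwap k (punchIn j c) ≡ punchIn j (adjacentSwap k′ c)
  adjacentSwap-punchIn zero    zero          j≢k _     = ⊥-elim (j≢k refl)
  adjacentSwap-punchIn zero    (suc zero)    _   j≢k+1 = ⊥-elim (j≢k+1 refl)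
  adjacentSwap-punchIn {suc m} zero (suc (suc j)) _ _  =
    zero , λ { zero → refl ; (suc zero) → refl ; (suc (suc c)) → refl }
  adjacentSwap-punchIn {suc m} (suc k) zero  _   _     = k , λ c → refl
  adjacentSwap-punchIn {suc m} (suc k) (suc j) j≢k j≢k+1
    with adjacentSwap-punchIn k j (j≢k ∘ cong suc) (j≢k+1 ∘ cong suc)
  ... | k′ , commutes = suc k′ , λ { zero → refl ; (suc c) → cong suc (commutes c) }

  Σℤ-adjacentSwap : ∀ {n} (k : Fin n) (f : Fin (suc n) → ℤ) → Σℤ (f ∘ adjacentSwap k) ≡ Σℤ f
  Σℤ-adjacentSwap {suc n} zero    f = x∙yz≈y∙xz (f (suc zero)) (f zero) (Σℤ (λ i → f (suc (suc i))))
  Σℤ-adjacentSwap         (suc k) f = cong (λ s → f zero + s) (Σℤ-adjacentSwap k (f ∘ suc))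

  det-swapRows : ∀ {n} (k : Fin n) (M : Matrix (suc n)) → det (M ∘ adjacentSwap k) ≡ - det M
  det-swapRows zero M = det-swap₀₁ M
  det-swapRows {suc n} (suc k) M = begin
    Σℤ (λ j → sign j * (M zero j * det (minor M j ∘ adjacentSwap k)))
      ≡⟨ Σℤ-cong (λ j → cong (λ d → sign j * (M zero j * d)) (det-swapRows k (minor M j))) ⟩
    Σℤ (λ j → sign j * (M zero j * - det (minor M j)))
      ≡⟨ Σℤ-cong (λ j → pull-neg (sign j) (M zero j) (det (minor M j))) ⟩
    Σℤ (λ j → - laplaceTerm M j)
      ≡⟨ Σℤ-neg (laplaceTerm M) ⟩
    - det M ∎
    where
    pull-neg : ∀ a b c → a * (b * - c) ≡ - (a * (b * c))
    pull-neg = solve-∀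

  laplaceTerm-permuteColumns : ∀ {n} (σ : Fin (suc n) → Fin (suc n)) (M : Matrix (suc n)) (i j : Fin (suc n)) →
    σ i ≡ j → (∀ c → σ (punchIn i c) ≡ punchIn j c) → sign i ≡ - sign j →
    laplaceTerm (λ r → M r ∘ σ) i ≡ - laplaceTerm M j
  laplaceTerm-permuteColumns σ M i j σi≡j σ-punchIn sign-flips = begin
    sign i * (M zero (σ i) * det (λ r c → M (suc r) (σ (punchIn i c))))
      ≡⟨ cong₂ (λ s a → s * (M zero a * det (λ r c → M (suc r) (σ (punchIn i c))))) sign-flips σi≡j ⟩
    - sign j * (M zero j * det (λ r c → M (suc r) (σ (punchIn i c))))
      ≡⟨ cong (λ d → - sign j * (M zero j * d)) (det-cong (λ r c → cong (M (suc r)) (σ-punchIn c))) ⟩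
    - sign j * (M zero j * det (minor M j))
      ≡˘⟨ neg-distribˡ-* (sign j) _ ⟩
    - laplaceTerm M j ∎

  det-swapColumns : ∀ {n} (k : Fin n) (M : Matrix (suc n)) → det (λ r → M r ∘ adjacentSwap k) ≡ - det M
  det-swapColumns {suc m} k M = begin
    Σℤ (laplaceTerm M′)                          ≡˘⟨ Σℤ-adjacentSwap k (laplaceTerm M′) ⟩
    Σℤ (laplaceTerm M′ ∘ adjacentSwap k)         ≡⟨ Σℤ-cong term ⟩
    Σℤ (λ j → - laplaceTerm M j)                 ≡⟨ Σℤ-neg (laplaceTerm M) ⟩
    - det M                                      ∎
    where
    M′ : Matrix (suc (suc m))
    M′ r = M r ∘ adjacentSwap k
    term : ∀ j → laplaceTerm M′ (adjacentSwap k j) ≡ - laplaceTerm M j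
    term j with j ≟ inject₁ k | j ≟ suc k
    ... | yes refl | _ = trans (cong (laplaceTerm M′) (adjacentSwap-inject₁ k))
      (laplaceTerm-permuteColumns (adjacentSwap k) M (suc k) (inject₁ k) (adjacentSwap-suc k)
        (adjacentSwap-punchIn-suc k) (sign-suc-inject₁ k))
    ... | no _ | yes refl = trans (cong (laplaceTerm M′) (adjacentSwap-suc k))
      (laplaceTerm-permuteColumns (adjacentSwap k) M (inject₁ k) (suc k) (adjacentSwap-inject₁ k)
        (adjacentSwap-punchIn-inject₁ k) (sign-inject₁-suc k))
    ... | no j≢k | no j≢k+1 with adjacentSwap-punchIn k j j≢k j≢k+1
    ... | k′ , commutes = begin
      laplaceTerm M′ (adjacentSwap k j)
        ≡⟨ cong (laplaceTerm M′) (adjacentSwap-fixes k j j≢k j≢k+1) ⟩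
      sign j * (M zero (adjacentSwap k j) * det (λ r c → M (suc r) (adjacentSwap k (punchIn j c))))
        ≡⟨ cong₂ (λ a d → sign j * (M zero a * d)) (adjacentSwap-fixes k j j≢k j≢k+1)
             (det-cong (λ r c → cong (M (suc r)) (commutes c))) ⟩
      sign j * (M zero j * det (λ r → minor M j r ∘ adjacentSwap k′))
        ≡⟨ cong (λ d → sign j * (M zero j * d)) (det-swapColumns k′ (minor M j)) ⟩
      sign j * (M zero j * - det (minor M j))
        ≡⟨ pull-neg (sign j) (M zero j) (det (minor M j)) ⟩
      - laplaceTerm M j ∎
      where
      pull-neg : ∀ a b c → a * (b * - c) ≡ - (a * (b * c))
      pull-neg = solve-∀

  det-swapBoth : ∀ {n} (k : Fin n) (M : Matrix (suc n)) →
    det (λ i j → M (adjacentSwap k i) (adjacentSwap k j)) ≡ det M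
  det-swapBoth k M = begin
    det (λ i j → M (adjacentSwap k i) (adjacentSwap k j))  ≡⟨ det-swapRows k (λ i → M i ∘ adjacentSwap k) ⟩
    - det (λ i → M i ∘ adjacentSwap k)                       ≡⟨ cong -_ (det-swapColumns k M) ⟩
    - - det M                                                ≡⟨ neg-involutive (det M) ⟩
    det M                                                    ∎

  -- Invariance under simultaneous permutation of rows and columns

  applyWord : ∀ {n} → List (Fin n) → Fin (suc n) → Fin (suc n)
  applyWord []      i = i
  applyWord (k ∷ w) i = applyWord w (adjacentSwap k i)

  det-applyWord : ∀ {n} (w : List (Fin n)) (M : Matrix (suc n)) →
    det (λ i j → M (applyWord w i) (applyWord w j)) ≡ det M
  det-applyWord []      M = refl
  det-applyWord (k ∷ w) M = trans (det-swapBoth k (λ i j → M (applyWord w i) (applyWord w j))) (det-applyWord w M)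

  applyWord-++ : ∀ {n} (v w : List (Fin n)) i → applyWord (v ++ w) i ≡ applyWord w (applyWord v i)
  applyWord-++ []      w i = refl
  applyWord-++ (k ∷ v) w i = applyWord-++ v w (adjacentSwap k i)

  applyWord-map-suc-zero : ∀ {n} (w : List (Fin n)) → applyWord (map suc w) zero ≡ zero
  applyWord-map-suc-zero []      = refl
  applyWord-map-suc-zero (k ∷ w) = applyWord-map-suc-zero w

  applyWord-map-suc-suc : ∀ {n} (w : List (Fin n)) i → applyWord (map suc w) (suc i) ≡ suc (applyWord w i)
  applyWord-map-suc-suc []      i = refl
  applyWord-map-suc-suc (k ∷ w) i = applyWord-map-suc-suc w (adjacentSwap k i)

  insertAt : ∀ {n} → Fin (suc n) → List (Fin n)
  insertAt zero            = []
  insertAt {suc n} (suc b) = zero ∷ map suc (insertAt b)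

  applyWord-insertAt-zero : ∀ {n} (b : Fin (suc n)) → applyWord (insertAt b) zero ≡ b
  applyWord-insertAt-zero zero            = refl
  applyWord-insertAt-zero {suc n} (suc b) =
    trans (applyWord-map-suc-suc (insertAt b) zero) (cong suc (applyWord-insertAt-zero b))

  applyWord-insertAt-suc : ∀ {n} (b : Fin (suc n)) (i : Fin n) → applyWord (insertAt b) (suc i) ≡ punchIn b i
  applyWord-insertAt-suc zero            i       = refl
  applyWord-insertAt-suc {suc n} (suc b) zero    = applyWord-map-suc-zero (insertAt b)
  applyWord-insertAt-suc {suc n} (suc b) (suc i) =
    trans (applyWord-map-suc-suc (insertAt b) (suc i)) (cong suc (applyWord-insertAt-suc b i))

  -- Take out the image of 0, decompose the rest, and then move 0 to its image.
  injective⇒word : ∀ {n} (π : Fin (suc n) → Fin (suc n)) → Injective _≡_ _≡_ π →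
    Σ (List (Fin n)) λ w → ∀ i → π i ≡ applyWord w i
  injective⇒word {zero} π _ = [] , λ { zero → only-zero (π zero) }
    where
    only-zero : (a : Fin 1) → a ≡ zero
    only-zero zero = refl
  injective⇒word {suc n} π π-inj =
    map suc w ++ insertAt (π zero) , λ i → sym (trans (applyWord-++ (map suc w) (insertAt (π zero)) i) (factor i))
    where
    π0≢π : ∀ i → ¬ π zero ≡ π (suc i)
    π0≢π i e with π-inj e
    ... | ()
    π′ : Fin (suc n) → Fin (suc n)
    π′ i = punchOut (π0≢π i)
    π′-inj : Injective _≡_ _≡_ π′
    π′-inj {i} {j} e = suc-injective (π-inj (punchOut-injective (π0≢π i) (π0≢π j) e))
    w : List (Fin n)
    w = proj₁ (injective⇒word π′ π′-inj)
    π′≗w : ∀ i → π′ i ≡ applyWord w i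
    π′≗w = proj₂ (injective⇒word π′ π′-inj)
    factor : ∀ i → applyWord (insertAt (π zero)) (applyWord (map suc w) i) ≡ π i
    factor zero =
      trans (cong (applyWord (insertAt (π zero))) (applyWord-map-suc-zero w)) (applyWord-insertAt-zero (π zero))
    factor (suc i) = begin
      applyWord (insertAt (π zero)) (applyWord (map suc w) (suc i))
        ≡⟨ cong (applyWord (insertAt (π zero))) (applyWord-map-suc-suc w i) ⟩
      applyWord (insertAt (π zero)) (suc (applyWord w i))
        ≡⟨ applyWord-insertAt-suc (π zero) (applyWord w i) ⟩
      punchIn (π zero) (applyWord w i)
        ≡˘⟨ cong (punchIn (π zero)) (π′≗w i) ⟩
      punchIn (π zero) (punchOut (π0≢π i))
        ≡⟨ punchIn-punchOut (π0≢π i) ⟩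
      π (suc i) ∎

  det-reindex : ∀ {m n} → m ≡ n → (π : Fin m → Fin n) → Injective _≡_ _≡_ π → (M : Matrix n) →
    det (λ i j → M (π i) (π j)) ≡ det M
  det-reindex {zero}  refl π π-inj M = refl
  det-reindex {suc n} refl π π-inj M =
    trans (det-cong (λ i j → cong₂ M (π≗w i) (π≗w j))) (det-applyWord w M)
    where
    w : List (Fin n)
    w = proj₁ (injective⇒word π π-inj)
    π≗w : ∀ i → π i ≡ applyWord w i
    π≗w = proj₂ (injective⇒word π π-inj)

  -- Block triangular matrices

  punchIn-↑ˡ : ∀ {m} n (b : Fin (suc m)) (c : Fin m) → punchIn (b ↑ˡ n) (c ↑ˡ n) ≡ punchIn b c ↑ˡ n
  punchIn-↑ˡ n zero    c       = refl
  punchIn-↑ˡ n (suc b) zero    = refl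
  punchIn-↑ˡ n (suc b) (suc c) = cong suc (punchIn-↑ˡ n b c)

  punchIn-↑ʳ : ∀ m {n} (b : Fin (suc m)) (c : Fin n) → punchIn (b ↑ˡ n) (m ↑ʳ c) ≡ suc m ↑ʳ c
  punchIn-↑ʳ m       zero    c = refl
  punchIn-↑ʳ (suc m) (suc b) c = cong suc (punchIn-↑ʳ m b c)

  sign-↑ˡ : ∀ {m} n (b : Fin m) → sign (b ↑ˡ n) ≡ sign b
  sign-↑ˡ n zero          = refl
  sign-↑ˡ n (suc zero)    = refl
  sign-↑ˡ n (suc (suc b)) = sign-↑ˡ n b

  det-blockTriangular : ∀ m {n} (M : Matrix (m +ℕ n)) (A : Matrix m) (B : Matrix n) →
    (∀ i j → M (i ↑ˡ n) (j ↑ˡ n) ≡ A i j) →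
    (∀ i j → M (m ↑ʳ i) (m ↑ʳ j) ≡ B i j) →
    (∀ i j → M (i ↑ˡ n) (m ↑ʳ j) ≡ + 0) →
    det M ≡ det A * det B
  det-blockTriangular zero    M A B _ M≡B _ = trans (det-cong M≡B) (sym (*-identityˡ (det B)))
  det-blockTriangular (suc m) {n} M A B M≡A M≡B M≡0 = begin
    Σℤ (laplaceTerm M)
      ≡⟨ Σℤ-↑ (suc m) (laplaceTerm M) ⟩
    Σℤ (λ b → laplaceTerm M (b ↑ˡ n)) + Σℤ (λ i → laplaceTerm M (suc m ↑ʳ i))
      ≡⟨ cong₂ _+_ (Σℤ-cong leftColumns) (Σℤ-vanish _ rightColumns) ⟩
    Σℤ (λ b → laplaceTerm A b * det B) + + 0
      ≡⟨ +-identityʳ _ ⟩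
    Σℤ (λ b → laplaceTerm A b * det B)
      ≡⟨ Σℤ-*ʳ (det B) (laplaceTerm A) ⟩
    det A * det B ∎
    where
    leftColumns : ∀ b → laplaceTerm M (b ↑ˡ n) ≡ laplaceTerm A b * det B
    leftColumns b = begin
      sign (b ↑ˡ n) * (M zero (b ↑ˡ n) * det (minor M (b ↑ˡ n)))
        ≡⟨ cong₂ (λ s d → s * (M zero (b ↑ˡ n) * d)) (sign-↑ˡ n b)
             (det-blockTriangular m (minor M (b ↑ˡ n)) (minor A b) B
               (λ i c → trans (cong (M (suc (i ↑ˡ n))) (punchIn-↑ˡ n b c)) (M≡A (suc i) (punchIn b c)))
               (λ i c → trans (cong (M (suc (m ↑ʳ i))) (punchIn-↑ʳ m b c)) (M≡B i c))
               (λ i c → trans (cong (M (suc (i ↑ˡ n))) (punchIn-↑ʳ m b c)) (M≡0 (suc i) c))) ⟩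
      sign b * (M zero (b ↑ˡ n) * (det (minor A b) * det B))
        ≡⟨ cong (λ a → sign b * (a * (det (minor A b) * det B))) (M≡A zero b) ⟩
      sign b * (A zero b * (det (minor A b) * det B))
        ≡⟨ regroup (sign b) (A zero b) (det (minor A b)) (det B) ⟩
      laplaceTerm A b * det B ∎
      where
      regroup : ∀ a b c d → a * (b * (c * d)) ≡ a * (b * c) * d
      regroup = solve-∀
    rightColumns : ∀ i → laplaceTerm M (suc m ↑ʳ i) ≡ + 0
    rightColumns i = begin
      sign (suc m ↑ʳ i) * (M zero (suc m ↑ʳ i) * det (minor M (suc m ↑ʳ i)))
        ≡⟨ cong (λ a → sign (suc m ↑ʳ i) * (a * det (minor M (suc m ↑ʳ i)))) (M≡0 zero i) ⟩
      sign (suc m ↑ʳ i) * (+ 0 * det (minor M (suc m ↑ʳ i)))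
        ≡⟨ *-zeroʳ (sign (suc m ↑ʳ i)) ⟩
      + 0 ∎

  det-blockTriangular₃ : ∀ {n} (M : Matrix (n +ℕ (n +ℕ n))) (A : Matrix n) →
    (∀ i j → M (i ↑ˡ (n +ℕ n)) (j ↑ˡ (n +ℕ n)) ≡ A i j) →
    (∀ i j → M (i ↑ˡ (n +ℕ n)) (n ↑ʳ j) ≡ + 0) →
    (∀ i j → M (n ↑ʳ (i ↑ˡ n)) (n ↑ʳ (j ↑ˡ n)) ≡ A i j) →
    (∀ i j → M (n ↑ʳ (i ↑ˡ n)) (n ↑ʳ (n ↑ʳ j)) ≡ + 0) →
    (∀ i j → M (n ↑ʳ (n ↑ʳ i)) (n ↑ʳ (n ↑ʳ j)) ≡ A i j) →
    det M ≡ det A * (det A * det A)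
  det-blockTriangular₃ {n} M A M₁₁≡A M₁₂≡0 M₂₂≡A M₂₃≡0 M₃₃≡A =
    trans (det-blockTriangular n M A lower M₁₁≡A (λ _ _ → refl) M₁₂≡0)
          (cong (det A *_) (det-blockTriangular n lower A A M₂₂≡A M₃₃≡A M₂₃≡0))
    where
    lower : Matrix (n +ℕ n)
    lower i j = M (n ↑ʳ i) (n ↑ʳ j)

module Integrality where

  open import Data.Nat using (zero; suc; s≤s)
  open import Data.Fin using (Fin; zero; suc)
  open import Data.Integer using (ℤ; +_; _+_; _*_; _-_; _^_; _/_; _%_)
  open import Data.Integer.DivMod using (a≡a%n+[a/n]*n; n%d<d)
  open import Data.Integer.Divisibility.Signed using (_∣_; divides)
  open import Data.Integer.Tactic.RingSolver using (solve-∀)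
  open import Data.Product using (_,_)
  open import Relation.Binary.PropositionalEquality using (_≡_; refl; sym; trans; cong; cong₂; subst)

  *-pres-∣ : ∀ {k l a b} → k ∣ a → l ∣ b → k * l ∣ a * b
  *-pres-∣ {k} {l} (divides q a≡qk) (divides r b≡rl) =
    divides (q * r) (trans (cong₂ _*_ a≡qk b≡rl) (regroup q k r l))
    where
    regroup : ∀ q k r l → q * k * (r * l) ≡ q * r * (k * l)
    regroup = solve-∀

  3∣consecutive : ∀ x → + 3 ∣ x * ((x + + 1) * (x + + 2))
  3∣consecutive x with x % + 3 | a≡a%n+[a/n]*n x (+ 3) | n%d<d x (+ 3)
  ... | 0 | x≡3q | _ = divides (x / + 3 * ((+ 3 * (x / + 3) + + 1) * (+ 3 * (x / + 3) + + 2)))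
    (trans (cong (λ y → y * ((y + + 1) * (y + + 2))) x≡3q) (expand (x / + 3)))
    where
    expand : ∀ q → (+ 0 + q * + 3) * ((+ 0 + q * + 3 + + 1) * (+ 0 + q * + 3 + + 2))
                 ≡ q * ((+ 3 * q + + 1) * (+ 3 * q + + 2)) * + 3
    expand = solve-∀
  ... | 1 | x≡3q+1 | _ = divides ((+ 3 * (x / + 3) + + 1) * ((x / + 3 + + 1) * (+ 3 * (x / + 3) + + 2)))
    (trans (cong (λ y → y * ((y + + 1) * (y + + 2))) x≡3q+1) (expand (x / + 3)))
    where
    expand : ∀ q → (+ 1 + q * + 3) * ((+ 1 + q * + 3 + + 1) * (+ 1 + q * + 3 + + 2))
                 ≡ (+ 3 * q + + 1) * ((q + + 1) * (+ 3 * q + + 2)) * + 3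
    expand = solve-∀
  ... | 2 | x≡3q+2 | _ = divides ((+ 3 * (x / + 3) + + 2) * ((+ 3 * (x / + 3) + + 4) * (x / + 3 + + 1)))
    (trans (cong (λ y → y * ((y + + 1) * (y + + 2))) x≡3q+2) (expand (x / + 3)))
    where
    expand : ∀ q → (+ 2 + q * + 3) * ((+ 2 + q * + 3 + + 1) * (+ 2 + q * + 3 + + 2))
                 ≡ (+ 3 * q + + 2) * ((+ 3 * q + + 4) * (q + + 1)) * + 3
    expand = solve-∀
  ... | suc (suc (suc _)) | _ | s≤s (s≤s (s≤s ()))

  consecutiveProduct : (ℤ → ℤ) → ℤ → ℤ
  consecutiveProduct p a = p a * (p (a + + 1) * p (a + + 2))

  consecutiveProduct-cong₃ : ∀ (p q : ℤ → ℤ) a →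
    p a ≡ q a → p (a + + 1) ≡ q (a + + 1) → p (a + + 2) ≡ q (a + + 2) →
    consecutiveProduct p a ≡ consecutiveProduct q a
  consecutiveProduct-cong₃ p q a pa≡qa pa+1≡qa+1 pa+2≡qa+2 = cong₂ _*_ pa≡qa (cong₂ _*_ pa+1≡qa+1 pa+2≡qa+2)

  consecutiveProduct-cong : ∀ {p q : ℤ → ℤ} → (∀ t → p t ≡ q t) → ∀ a →
    consecutiveProduct p a ≡ consecutiveProduct q a
  consecutiveProduct-cong {p} {q} p≗q a =
    consecutiveProduct-cong₃ p q a (p≗q a) (p≗q (a + + 1)) (p≗q (a + + 2))

  3^n∣Π-consecutive : ∀ {n} (ev : Fin n → ℤ) (a : ℤ) →
    (+ 3) ^ n ∣ consecutiveProduct (λ t → Πℤ (λ i → t - ev i)) a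
  3^n∣Π-consecutive {zero}  ev a = divides (+ 1) refl
  3^n∣Π-consecutive {suc n} ev a =
    subst ((+ 3) ^ suc n ∣_) (sym (regroup a (ev zero) (P a) (P (a + + 1)) (P (a + + 2))))
      (*-pres-∣ (3∣consecutive (a - ev zero)) (3^n∣Π-consecutive (λ i → ev (suc i)) a))
    where
    P : ℤ → ℤ
    P t = Πℤ (λ i → t - ev (suc i))
    regroup : ∀ a l p q r → (a - l) * p * (((a + + 1) - l) * q * (((a + + 2) - l) * r))
                            ≡ (a - l) * (((a - l) + + 1) * ((a - l) + + 2)) * (p * (q * r))
    regroup = solve-∀

  -- Among three consecutive integers one is divisible by 3, so every eigenvalue contributes a factor 3.
  integral⇒3^n∣consecutiveProduct : ∀ {n} (A : Matrix n) → IsIntegralMatrix A → ∀ a →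
    (+ 3) ^ n ∣ consecutiveProduct (charPolyAt A) a
  integral⇒3^n∣consecutiveProduct {n} A (ev , charPoly≡Π) a =
    subst ((+ 3) ^ n ∣_) (sym (consecutiveProduct-cong charPoly≡Π a)) (3^n∣Π-consecutive ev a)

module Cayley where

  open Determinant using (det-cong; det-reindex)
  open Integrality using (consecutiveProduct; consecutiveProduct-cong; integral⇒3^n∣consecutiveProduct)
  open import Data.Nat.Properties using (≤-antisym)
  open import Data.Fin using (Fin; zero; suc; _≟_)
  open import Data.Fin.Properties using (injective⇒≤; any?)
  open import Data.Integer using (ℤ; +_; _*_; _-_; _^_)
  open import Data.Integer.Divisibility.Signed using (_∣_)
  open import Data.Bool using (Bool; if_then_else_; T)
  open import Data.List using (List; _∷_; length; lookup)
  open import Data.List.Relation.Unary.Any as Any using (Any)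
  open import Data.List.Relation.Unary.Any.Properties using (lookup-index)
  open import Data.List.Relation.Unary.All as All using (All)
  open import Data.List.Relation.Unary.Unique.Propositional using (Unique)
  open import Data.List.Relation.Unary.AllPairs using (_∷_)
  open import Data.List.Relation.Binary.Subset.Propositional using (_⊆_)
  open import Data.List.Membership.Propositional using (_∈_; find)
  open import Data.List.Membership.Propositional.Properties using (∈-lookup)
  open import Data.List.Membership.DecPropositional _≟P_ using (_∈?_)
  open import Data.Product using (_,_; _×_; ∃-syntax)
  open import Data.Empty using (⊥-elim)
  open import Function using (mk⇔)
  open import Function.Definitions using (Injective)
  open import Relation.Nullary using (¬_; Dec; does)
  open import Relation.Nullary.Decidable using (isYes; does-⇔; toWitness; fromWitness)
  open import Relation.Binary.PropositionalEquality

  module _ {A : Set} where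

    lookup-injective : ∀ {xs : List A} → Unique xs → Injective _≡_ _≡_ (lookup xs)
    lookup-injective {_ ∷ _} (_   ∷ _)      {zero}  {zero}  _ = refl
    lookup-injective {_ ∷ _} (x∉ ∷ _)       {zero}  {suc j} e = ⊥-elim (All.lookup x∉ (∈-lookup j) e)
    lookup-injective {_ ∷ _} (x∉ ∷ _)       {suc i} {zero}  e = ⊥-elim (All.lookup x∉ (∈-lookup i) (sym e))
    lookup-injective {_ ∷ _} (_   ∷ unique) {suc i} {suc j} e = cong suc (lookup-injective unique e)

    gram : (A → A → ℤ) → (xs : List A) → Matrix (length xs)
    gram g xs i j = g (lookup xs i) (lookup xs j)

    module _ {xs ys : List A} (xs-unique : Unique xs) (xs⊆ys : xs ⊆ ys) where

      embedding : Fin (length xs) → Fin (length ys)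
      embedding i = Any.index (xs⊆ys (∈-lookup i))

      lookup-embedding : ∀ i → lookup ys (embedding i) ≡ lookup xs i
      lookup-embedding i = sym (lookup-index (xs⊆ys (∈-lookup i)))

      embedding-injective : Injective _≡_ _≡_ embedding
      embedding-injective {i} {j} e =
        lookup-injective xs-unique (trans (sym (lookup-embedding i)) (trans (cong (lookup ys) e) (lookup-embedding j)))

    module _ {xs ys : List A} (xs-unique : Unique xs) (ys-unique : Unique ys) (xs⊆ys : xs ⊆ ys) (ys⊆xs : ys ⊆ xs) where

      length-sameElements : length xs ≡ length ys
      length-sameElements =
        ≤-antisym (injective⇒≤ (embedding-injective xs-unique xs⊆ys))
                  (injective⇒≤ (embedding-injective ys-unique ys⊆xs))

      det-gram-sameElements : (g : A → A → ℤ) → det (gram g xs) ≡ det (gram g ys)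
      det-gram-sameElements g = begin
        det (gram g xs)
          ≡˘⟨ det-cong (λ i j → cong₂ g (lookup-embedding xs-unique xs⊆ys i)
                                         (lookup-embedding xs-unique xs⊆ys j)) ⟩
        det (λ i j → gram g ys (embedding xs-unique xs⊆ys i) (embedding xs-unique xs⊆ys j))
          ≡⟨ det-reindex length-sameElements (embedding xs-unique xs⊆ys)
                         (embedding-injective xs-unique xs⊆ys) (gram g ys) ⟩
        det (gram g ys) ∎
        where open ≡-Reasoning

  indicator : Bool → ℤ
  indicator b = if b then + 1 else + 0

  -- entry (u, v) of t·I − A, where A u v = 1 iff u v⁻¹ ∈ S
  charEntry : List Perm4 → ℤ → Perm4 → Perm4 → ℤ
  charEntry S t u v = t * indicator (does (u ≟P v)) - indicator (does (Any.any? (λ s → u ≟P (s ∘P v)) S))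

  subsetOf : (H S : List Perm4) → Fin (length H) → Bool
  subsetOf H S l = isYes (elt H l ∈? S)

  module _ {H S : List Perm4} (S⊆H : S ⊆ H) where

    -- D is the decision procedure used inside cayleyAdj, which cannot be named.
    adjacency-indicator : ∀ x y (D : ∀ l → Dec (T (subsetOf H S l) × elt H x ≡ elt H l ∘P elt H y)) →
      indicator (does (any? D)) ≡ indicator (does (Any.any? (λ s → elt H x ≟P (s ∘P elt H y)) S))
    adjacency-indicator x y D = cong indicator (does-⇔ (mk⇔ toS fromS) (any? D) (Any.any? _ S))
      where
      toS : ∃[ l ] (T (subsetOf H S l) × elt H x ≡ elt H l ∘P elt H y) → Any (λ s → elt H x ≡ s ∘P elt H y) S
      toS (l , l∈S , x≡ly) =
        Any.map (λ l≡s → subst (λ s → elt H x ≡ s ∘P elt H y) l≡s x≡ly) (toWitness l∈S)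
      fromS : Any (λ s → elt H x ≡ s ∘P elt H y) S → ∃[ l ] (T (subsetOf H S l) × elt H x ≡ elt H l ∘P elt H y)
      fromS adj with find adj
      ... | s , s∈S , x≡sy =
        Any.index s∈H
        , fromWitness (subst (_∈ S) (lookup-index s∈H) s∈S)
        , subst (λ s → elt H x ≡ s ∘P elt H y) (lookup-index s∈H) x≡sy
        where
        s∈H : s ∈ H
        s∈H = S⊆H s∈S

    charPolyAt-cayleyAdj : Unique H → ∀ t → charPolyAt (cayleyAdj H (subsetOf H S)) t ≡ det (gram (charEntry S t) H)
    charPolyAt-cayleyAdj H-unique t = det-cong λ x y →
      cong₂ (λ a b → t * a - b)
        (cong indicator (does-⇔ (mk⇔ (cong (elt H)) (lookup-injective H-unique)) (x ≟ y) (elt H x ≟P elt H y)))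
        (adjacency-indicator x y _)

    subsetOf-symmetric : All (λ s → Any (λ s′ → s′ ∘P s ≡ idP) S) S → Symmetric H (subsetOf H S)
    subsetOf-symmetric inverses l l∈S =
      let s′ , s′∈S , s′s≡id = find (All.lookup inverses (toWitness l∈S))
          s′∈H = S⊆H s′∈S
      in Any.index s′∈H
       , fromWitness (subst (_∈ S) (lookup-index s′∈H) s′∈S)
       , subst (λ s → s ∘P elt H l ≡ idP) (lookup-index s′∈H) s′s≡id

  -- Certifies that no group whose elements are those of X, in any order, is Cayley integral.
  record NonIntegralityWitness (X : List Perm4) : Set where
    field
      unique      : Unique X
      S           : List Perm4
      S⊆X         : All (_∈ X) S
      inverses    : All (λ s → Any (λ s′ → s′ ∘P s ≡ idP) S) S
      a           : ℤ
      indivisible : ¬ ((+ 3) ^ length X ∣ consecutiveProduct (λ t → det (gram (charEntry S t) X)) a)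

  witness⇒¬cayleyIntegral : ∀ {X H} → NonIntegralityWitness X → Unique H → H ⊆ X → X ⊆ H → ¬ CayleyIntegral H
  witness⇒¬cayleyIntegral {X} {H} w H-unique H⊆X X⊆H integral =
    indivisible (subst (λ n → (+ 3) ^ n ∣ consecutiveProduct (λ t → det (gram (charEntry S t) X)) a)
                       (length-sameElements H-unique unique H⊆X X⊆H)
                       (subst ((+ 3) ^ length H ∣_) (consecutiveProduct-cong charPoly≗ a) 3^n∣charPoly))
    where
    open NonIntegralityWitness w
    S⊆H : S ⊆ H
    S⊆H s∈S = X⊆H (All.lookup S⊆X s∈S)
    3^n∣charPoly : (+ 3) ^ length H ∣ consecutiveProduct (charPolyAt (cayleyAdj H (subsetOf H S))) a
    3^n∣charPoly = integral⇒3^n∣consecutiveProduct _ (integral (subsetOf H S) (subsetOf-symmetric S⊆H inverses)) a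
    charPoly≗ : ∀ t → charPolyAt (cayleyAdj H (subsetOf H S)) t ≡ det (gram (charEntry S t) X)
    charPoly≗ t = trans (charPolyAt-cayleyAdj S⊆H H-unique t)
                        (det-gram-sameElements H-unique unique H⊆X X⊆H (charEntry S t))

module Evaluation where

  open Sums using (Σℤ-cong)
  open Determinant using (det-cong)
  open Integrality using (consecutiveProduct; consecutiveProduct-cong)
  open import Data.Nat using (zero; suc)
  open import Data.Fin using (zero; suc; punchIn)
  open import Data.Integer using (ℤ; +_; -[1+_]; _*_)
  open import Data.Integer.Divisibility.Signed using (_∣_; _∣?_)
  open import Data.Vec using (Vec; _∷_; lookup; map; tabulate; removeAt)
  open import Data.Vec.Properties using (lookup-map; lookup∘tabulate)
  open import Function using (_∘_)
  open import Relation.Nullary using (¬_)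
  open import Relation.Nullary.Decidable using (False; toWitnessFalse)
  open import Relation.Binary.PropositionalEquality

  -- Unlike _*_, this does not evaluate its second argument when the first is 0,
  -- which prunes the Laplace expansion of sparse matrices.
  infixl 7 _*′_
  _*′_ : ℤ → ℤ → ℤ
  (+ zero) *′ y = + 0
  x        *′ y = x * y

  *′≡* : ∀ x y → x *′ y ≡ x * y
  *′≡* (+ zero)    y = refl
  *′≡* (+ suc _)   y = refl
  *′≡* (-[1+ _ ]) y = refl

  fastDet : ∀ {n} → Vec (Vec ℤ n) n → ℤ
  fastDet {zero}  _        = + 1
  fastDet {suc n} (r ∷ rs) = Σℤ (λ j → sign j * (lookup r j *′ fastDet (map (λ row → removeAt row j) rs)))

  lookup-removeAt : ∀ {n} {A : Set} (v : Vec A (suc n)) j c → lookup (removeAt v j) c ≡ lookup v (punchIn j c)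
  lookup-removeAt (x ∷ v)     zero    c       = refl
  lookup-removeAt (x ∷ y ∷ v) (suc j) zero    = refl
  lookup-removeAt (x ∷ y ∷ v) (suc j) (suc c) = lookup-removeAt (y ∷ v) j c

  fastDet-correct : ∀ {n} (V : Vec (Vec ℤ n) n) → fastDet V ≡ det (λ i j → lookup (lookup V i) j)
  fastDet-correct {zero}  V        = refl
  fastDet-correct {suc n} (r ∷ rs) = Σℤ-cong λ j →
    trans (cong (sign j *_) (*′≡* (lookup r j) _))
          (cong (λ d → sign j * (lookup r j * d)) (trans (fastDet-correct (map (λ row → removeAt row j) rs))
            (det-cong (λ i c → trans (cong (λ row → lookup row c) (lookup-map i (λ row → removeAt row j) rs))
                                      (lookup-removeAt (lookup rs i) j c)))))

  toVec : ∀ {n} → Matrix n → Vec (Vec ℤ n) n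
  toVec M = tabulate (λ i → tabulate (M i))

  det≡fastDet : ∀ {n} (M : Matrix n) → det M ≡ fastDet (toVec M)
  det≡fastDet M = sym (trans (fastDet-correct (toVec M)) (det-cong λ i j →
    trans (cong (λ row → lookup row j) (lookup∘tabulate (λ i → tabulate (M i)) i)) (lookup∘tabulate (M i) j)))

  indivisible-by-evaluation : ∀ {n} (M : ℤ → Matrix n) (k a : ℤ) →
    False (k ∣? consecutiveProduct (fastDet ∘ toVec ∘ M) a) → ¬ (k ∣ consecutiveProduct (det ∘ M) a)
  indivisible-by-evaluation M k a evaluated =
    subst (λ p → ¬ (k ∣ p)) (sym (consecutiveProduct-cong (det≡fastDet ∘ M) a)) (toWitnessFalse evaluated)

module Subgroups where

  open Determinant using (det-blockTriangular₃)
  open Integrality using (consecutiveProduct; consecutiveProduct-cong₃)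
  open Cayley using (charEntry; gram; NonIntegralityWitness)
  open Evaluation using (fastDet; toVec; det≡fastDet; indivisible-by-evaluation)
  open import Data.Nat using () renaming (_+_ to _+ℕ_)
  open import Data.Fin using (Fin; _↑ˡ_; _↑ʳ_)
  open import Data.Fin.Patterns using (0F; 1F; 2F; 3F)
  open import Data.Fin.Properties using (all?)
  open import Data.Integer using (ℤ; +_; _+_; _*_; _^_) renaming (_≟_ to _≟ℤ_)
  open import Data.Integer.Divisibility.Signed using (_∣_; _∣?_)
  open import Data.Vec using (_∷_; [])
  open import Data.List using (List; []; _∷_; _++_; map; length)
  open import Data.List.Relation.Unary.All as All using (All)
  open import Data.List.Relation.Unary.Any as Any using (Any)
  open import Data.List.Relation.Unary.AllPairs using (allPairs?)
  open import Data.List.Relation.Unary.Unique.Propositional using (Unique)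
  open import Data.List.Membership.DecPropositional _≟P_ using (_∈?_)
  open import Data.Product using (_×_; _,_)
  open import Relation.Nullary using (¬_; Dec; ¬?)
  open import Relation.Nullary.Decidable using (True; False; toWitness; toWitnessFalse; _×-dec_)
  open import Relation.Binary.PropositionalEquality

  dihedral₁ : List Perm4
  dihedral₁ =
    (0F ∷ 1F ∷ 2F ∷ 3F ∷ []) ∷ (2F ∷ 1F ∷ 0F ∷ 3F ∷ []) ∷ (3F ∷ 0F ∷ 1F ∷ 2F ∷ []) ∷
    (3F ∷ 2F ∷ 1F ∷ 0F ∷ []) ∷ (2F ∷ 3F ∷ 0F ∷ 1F ∷ []) ∷ (0F ∷ 3F ∷ 2F ∷ 1F ∷ []) ∷
    (1F ∷ 2F ∷ 3F ∷ 0F ∷ []) ∷ (1F ∷ 0F ∷ 3F ∷ 2F ∷ []) ∷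
    []

  dihedral₂ : List Perm4
  dihedral₂ =
    (0F ∷ 1F ∷ 2F ∷ 3F ∷ []) ∷ (1F ∷ 0F ∷ 2F ∷ 3F ∷ []) ∷ (3F ∷ 2F ∷ 0F ∷ 1F ∷ []) ∷
    (3F ∷ 2F ∷ 1F ∷ 0F ∷ []) ∷ (1F ∷ 0F ∷ 3F ∷ 2F ∷ []) ∷ (0F ∷ 1F ∷ 3F ∷ 2F ∷ []) ∷
    (2F ∷ 3F ∷ 1F ∷ 0F ∷ []) ∷ (2F ∷ 3F ∷ 0F ∷ 1F ∷ []) ∷
    []

  dihedral₃ : List Perm4
  dihedral₃ =
    (0F ∷ 1F ∷ 2F ∷ 3F ∷ []) ∷ (3F ∷ 1F ∷ 2F ∷ 0F ∷ []) ∷ (2F ∷ 0F ∷ 3F ∷ 1F ∷ []) ∷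
    (2F ∷ 3F ∷ 0F ∷ 1F ∷ []) ∷ (3F ∷ 2F ∷ 1F ∷ 0F ∷ []) ∷ (0F ∷ 2F ∷ 1F ∷ 3F ∷ []) ∷
    (1F ∷ 3F ∷ 0F ∷ 2F ∷ []) ∷ (1F ∷ 0F ∷ 3F ∷ 2F ∷ []) ∷
    []

  alternating : List Perm4
  alternating =
    (0F ∷ 1F ∷ 2F ∷ 3F ∷ []) ∷ (0F ∷ 2F ∷ 3F ∷ 1F ∷ []) ∷ (0F ∷ 3F ∷ 1F ∷ 2F ∷ []) ∷
    (1F ∷ 0F ∷ 3F ∷ 2F ∷ []) ∷ (1F ∷ 2F ∷ 0F ∷ 3F ∷ []) ∷ (1F ∷ 3F ∷ 2F ∷ 0F ∷ []) ∷
    (2F ∷ 0F ∷ 1F ∷ 3F ∷ []) ∷ (2F ∷ 1F ∷ 3F ∷ 0F ∷ []) ∷ (2F ∷ 3F ∷ 0F ∷ 1F ∷ []) ∷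
    (3F ∷ 0F ∷ 2F ∷ 1F ∷ []) ∷ (3F ∷ 1F ∷ 0F ∷ 2F ∷ []) ∷ (3F ∷ 2F ∷ 1F ∷ 0F ∷ []) ∷
    []

  cyclic₁ : List Perm4
  cyclic₁ =
    (0F ∷ 1F ∷ 2F ∷ 3F ∷ []) ∷ (1F ∷ 2F ∷ 3F ∷ 0F ∷ []) ∷ (2F ∷ 3F ∷ 0F ∷ 1F ∷ []) ∷
    (3F ∷ 0F ∷ 1F ∷ 2F ∷ []) ∷
    []

  cyclic₂ : List Perm4
  cyclic₂ =
    (0F ∷ 1F ∷ 2F ∷ 3F ∷ []) ∷ (1F ∷ 3F ∷ 0F ∷ 2F ∷ []) ∷ (2F ∷ 0F ∷ 3F ∷ 1F ∷ []) ∷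
    (3F ∷ 2F ∷ 1F ∷ 0F ∷ []) ∷
    []

  cyclic₃ : List Perm4
  cyclic₃ =
    (0F ∷ 1F ∷ 2F ∷ 3F ∷ []) ∷ (1F ∷ 0F ∷ 3F ∷ 2F ∷ []) ∷ (2F ∷ 3F ∷ 1F ∷ 0F ∷ []) ∷
    (3F ∷ 2F ∷ 0F ∷ 1F ∷ []) ∷
    []

  klein : List Perm4
  klein =
    (0F ∷ 1F ∷ 2F ∷ 3F ∷ []) ∷ (1F ∷ 0F ∷ 3F ∷ 2F ∷ []) ∷ (2F ∷ 3F ∷ 0F ∷ 1F ∷ []) ∷
    (3F ∷ 2F ∷ 1F ∷ 0F ∷ []) ∷
    []

  -- the right cosets of dihedral₁, so that Cayley matrices with connection set in dihedral₁ are block diagonal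
  symmetricGroup : List Perm4
  symmetricGroup =
    dihedral₁ ++
    map (_∘P (0F ∷ 1F ∷ 3F ∷ 2F ∷ [])) dihedral₁ ++
    map (_∘P (0F ∷ 2F ∷ 1F ∷ 3F ∷ [])) dihedral₁

  reflections₁ : List Perm4
  reflections₁ =
    (2F ∷ 1F ∷ 0F ∷ 3F ∷ []) ∷ (1F ∷ 0F ∷ 3F ∷ 2F ∷ []) ∷
    []

  reflections₂ : List Perm4
  reflections₂ =
    (1F ∷ 0F ∷ 2F ∷ 3F ∷ []) ∷ (2F ∷ 3F ∷ 0F ∷ 1F ∷ []) ∷
    []

  reflections₃ : List Perm4
  reflections₃ =
    (3F ∷ 1F ∷ 2F ∷ 0F ∷ []) ∷ (1F ∷ 0F ∷ 3F ∷ 2F ∷ []) ∷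
    []

  alternatingConnection : List Perm4
  alternatingConnection =
    (1F ∷ 0F ∷ 3F ∷ 2F ∷ []) ∷ (1F ∷ 2F ∷ 0F ∷ 3F ∷ []) ∷ (2F ∷ 0F ∷ 1F ∷ 3F ∷ []) ∷
    (2F ∷ 3F ∷ 0F ∷ 1F ∷ []) ∷
    []

  unique? : (X : List Perm4) → Dec (Unique X)
  unique? = allPairs? (λ σ τ → ¬? (σ ≟P τ))

  closedUnderInverses? : (S : List Perm4) → Dec (All (λ s → Any (λ s′ → s′ ∘P s ≡ idP) S) S)
  closedUnderInverses? S = All.all? (λ s → Any.any? (λ s′ → (s′ ∘P s) ≟P idP) S) S

  witnessByEvaluation : ∀ X S a →
    True (unique? X) → True (All.all? (_∈? X) S) → True (closedUnderInverses? S) →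
    False ((+ 3) ^ length X ∣? consecutiveProduct (λ t → fastDet (toVec (gram (charEntry S t) X))) a) →
    NonIntegralityWitness X
  witnessByEvaluation X S a unique S⊆X inverses indivisible = record
    { unique      = toWitness unique
    ; S           = S
    ; S⊆X         = toWitness S⊆X
    ; inverses    = toWitness inverses
    ; a           = a
    ; indivisible = indivisible-by-evaluation (λ t → gram (charEntry S t) X) _ a indivisible
    }

  -- Cay(D₄, reflections) is an 8-cycle, with the irrational eigenvalues ±√2.
  dihedral₁-witness : NonIntegralityWitness dihedral₁
  dihedral₁-witness = witnessByEvaluation dihedral₁ reflections₁ (+ 3) _ _ _ _

  dihedral₂-witness : NonIntegralityWitness dihedral₂
  dihedral₂-witness = witnessByEvaluation dihedral₂ reflections₂ (+ 3) _ _ _ _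

  dihedral₃-witness : NonIntegralityWitness dihedral₃
  dihedral₃-witness = witnessByEvaluation dihedral₃ reflections₃ (+ 3) _ _ _ _

  alternating-witness : NonIntegralityWitness alternating
  alternating-witness = witnessByEvaluation alternating alternatingConnection (+ 5) _ _ _ _

  _≐?_ : ∀ {m n} (M N : Fin m → Fin n → ℤ) → Dec (∀ i j → M i j ≡ N i j)
  M ≐? N = all? λ i → all? λ j → M i j ≟ℤ N i j

  cube : ℤ → ℤ
  cube x = x * (x * x)

  module _ (t : ℤ) where

    private
      M : Matrix (8 +ℕ (8 +ℕ 8))
      M = gram (charEntry reflections₁ t) symmetricGroup
      A : Matrix 8
      A = gram (charEntry reflections₁ t) dihedral₁

    BlockTriangular : Set
    BlockTriangular = (∀ i j → M (i ↑ˡ 16) (j ↑ˡ 16) ≡ A i j) ×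
                    (∀ (i : Fin 8) j → M (i ↑ˡ 16) (8 ↑ʳ j) ≡ + 0) ×
                    (∀ i j → M (8 ↑ʳ (i ↑ˡ 8)) (8 ↑ʳ (j ↑ˡ 8)) ≡ A i j) ×
                    (∀ (i j : Fin 8) → M (8 ↑ʳ (i ↑ˡ 8)) (8 ↑ʳ (8 ↑ʳ j)) ≡ + 0) ×
                    (∀ i j → M (8 ↑ʳ (8 ↑ʳ i)) (8 ↑ʳ (8 ↑ʳ j)) ≡ A i j)

    blockTriangular? : Dec BlockTriangular
    blockTriangular? = ((λ i j → M (i ↑ˡ 16) (j ↑ˡ 16)) ≐? A) ×-dec
                     ((λ (i : Fin 8) j → M (i ↑ˡ 16) (8 ↑ʳ j)) ≐? (λ _ _ → + 0)) ×-dec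
                     ((λ i j → M (8 ↑ʳ (i ↑ˡ 8)) (8 ↑ʳ (j ↑ˡ 8))) ≐? A) ×-dec
                     ((λ (i j : Fin 8) → M (8 ↑ʳ (i ↑ˡ 8)) (8 ↑ʳ (8 ↑ʳ j))) ≐? (λ _ _ → + 0)) ×-dec
                     ((λ i j → M (8 ↑ʳ (8 ↑ʳ i)) (8 ↑ʳ (8 ↑ʳ j))) ≐? A)

    det-cayley-symmetricGroup : BlockTriangular →
      det (gram (charEntry reflections₁ t) symmetricGroup) ≡ cube (fastDet (toVec A))
    det-cayley-symmetricGroup (M₁₁≡A , M₁₂≡0 , M₂₂≡A , M₂₃≡0 , M₃₃≡A) =
      trans (det-blockTriangular₃ M A M₁₁≡A M₁₂≡0 M₂₂≡A M₂₃≡0 M₃₃≡A) (cong cube (det≡fastDet A))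

  symmetricGroup-witness : NonIntegralityWitness symmetricGroup
  symmetricGroup-witness = record
    { unique      = toWitness {a? = unique? symmetricGroup} _
    ; S           = reflections₁
    ; S⊆X         = toWitness {a? = All.all? (_∈? symmetricGroup) reflections₁} _
    ; inverses    = toWitness {a? = closedUnderInverses? reflections₁} _
    ; a           = + 3
    ; indivisible = subst (λ p → ¬ ((+ 3) ^ 24 ∣ p)) (sym evaluate) (toWitnessFalse {a? = (+ 3) ^ 24 ∣? _} _)
    }
    where
    byBlocks : ∀ t → True (blockTriangular? t) → det (gram (charEntry reflections₁ t) symmetricGroup)
                                               ≡ cube (fastDet (toVec (gram (charEntry reflections₁ t) dihedral₁)))
    byBlocks t blocks = det-cayley-symmetricGroup t (toWitness {a? = blockTriangular? t} blocks)
    -- The points are written + 3 + + 1 and + 3 + + 2 as in the field type: a mismatch such as + 4 would make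
    -- the type checker unfold the 24 × 24 determinant.
    evaluate : consecutiveProduct (λ t → det (gram (charEntry reflections₁ t) symmetricGroup)) (+ 3)
             ≡ consecutiveProduct (λ t → cube (fastDet (toVec (gram (charEntry reflections₁ t) dihedral₁)))) (+ 3)
    evaluate = consecutiveProduct-cong₃ (λ t → det (gram (charEntry reflections₁ t) symmetricGroup))
                 (λ t → cube (fastDet (toVec (gram (charEntry reflections₁ t) dihedral₁)))) (+ 3)
                 (byBlocks (+ 3) _) (byBlocks (+ 3 + + 1) _) (byBlocks (+ 3 + + 2) _)

module Generation where

  open import Data.Nat using (ℕ; zero; suc)
  open import Data.Fin using (Fin; zero; suc)
  open import Data.Bool using (Bool; true; false; if_then_else_; _∧_; _∨_)
  open import Data.Vec using (Vec; []; _∷_)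
  open import Data.List using (List; []; _∷_; map; concatMap; foldr)
  open import Data.List.Relation.Unary.All as All using (All; []; _∷_)
  open import Data.List.Relation.Unary.All.Properties using (++⁺; map⁺)
  open import Data.List.Relation.Binary.Subset.Propositional using (_⊆_)
  open import Data.List.Membership.Propositional using (_∈_)
  open import Data.Product using (_×_; _,_)

  _==ᶠ_ : ∀ {n} → Fin n → Fin n → Bool
  zero  ==ᶠ zero  = true
  suc i ==ᶠ suc j = i ==ᶠ j
  _     ==ᶠ _     = false

  _==_ : ∀ {n} → Vec (Fin 4) n → Vec (Fin 4) n → Bool
  []      == []      = true
  (i ∷ σ) == (j ∷ τ) = (i ==ᶠ j) ∧ (σ == τ)

  _∈ᵇ_ : Perm4 → List Perm4 → Bool
  σ ∈ᵇ []      = false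
  σ ∈ᵇ (τ ∷ K) = (σ == τ) ∨ (σ ∈ᵇ K)

  -- A data type rather than a pair of lists: for symbolic generators the search then stays
  -- stuck instead of unfolding all rounds (which makes type checking blow up).
  data Search : Set where
    search : (found new : List Perm4) → Search

  -- The membership test only avoids duplicates.
  visit : Perm4 → Search → Search
  visit σ (search K F) = if σ ∈ᵇ K then search K F else search (σ ∷ K) (σ ∷ F)

  products : List Perm4 → List Perm4 → List Perm4
  products F gs = concatMap (λ σ → map (σ ∘P_) gs) F

  explore : ℕ → List Perm4 → Search → List Perm4
  explore zero    gs (search K F) = K
  explore (suc d) gs (search K F) = explore d gs (foldr visit (search K []) (products F gs))

  generate : List Perm4 → List Perm4
  generate gs = explore 24 gs (search (idP ∷ []) (idP ∷ []))

  module _ {H : List Perm4} (H-subgroup : Subgroup H) where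
    open Subgroup H-subgroup

    Within : Search → Set
    Within (search K F) = All (_∈ H) K × All (_∈ H) F

    products⊆ : ∀ {F gs} → All (_∈ H) F → All (_∈ H) gs → All (_∈ H) (products F gs)
    products⊆ []           gs⊆H = []
    products⊆ (σ∈H ∷ F⊆H) gs⊆H = ++⁺ (map⁺ (All.map (closed σ∈H) gs⊆H)) (products⊆ F⊆H gs⊆H)

    visit⊆ : ∀ {σ} s → σ ∈ H → Within s → Within (visit σ s)
    visit⊆ {σ} (search K F) σ∈H (K⊆H , F⊆H) with σ ∈ᵇ K
    ... | true  = K⊆H , F⊆H
    ... | false = σ∈H ∷ K⊆H , σ∈H ∷ F⊆H

    foldr-visit⊆ : ∀ {σs} s → All (_∈ H) σs → Within s → Within (foldr visit s σs)
    foldr-visit⊆           s []           s⊆H = s⊆H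
    foldr-visit⊆ {_ ∷ σs} s (σ∈H ∷ σs⊆H) s⊆H = visit⊆ (foldr visit s σs) σ∈H (foldr-visit⊆ s σs⊆H s⊆H)

    explore⊆ : ∀ d {gs} s → All (_∈ H) gs → Within s → All (_∈ H) (explore d gs s)
    explore⊆ zero    (search K F) gs⊆H (K⊆H , _) = K⊆H
    explore⊆ (suc d) {gs} (search K F) gs⊆H (K⊆H , F⊆H) =
      explore⊆ d (foldr visit (search K []) (products F gs)) gs⊆H
        (foldr-visit⊆ (search K []) (products⊆ F⊆H gs⊆H) (K⊆H , []))

    generate⊆ : ∀ {gs} → All (_∈ H) gs → generate gs ⊆ H
    generate⊆ gs⊆H = All.lookup (explore⊆ 24 (search (idP ∷ []) (idP ∷ [])) gs⊆H (hasId ∷ [] , hasId ∷ []))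

module Classification where

  open Cayley using (NonIntegralityWitness; witness⇒¬cayleyIntegral; length-sameElements)
  open Subgroups
  open Generation
  open import Data.Fin using (_≟_)
  open import Data.Fin.Patterns using (0F; 1F; 2F; 3F)
  open import Data.Fin.Properties using (all?)
  import Data.Nat as ℕ
  open import Data.Vec using ([]; _∷_; lookup)
  open import Data.List using (List; []; _∷_; _++_; length)
  open import Data.List.Relation.Unary.All as All using (All; []; _∷_)
  open import Data.List.Relation.Unary.All.Properties using (¬All⇒Any¬)
  open import Data.List.Relation.Unary.Any as Any using (Any)
  open import Data.List.Relation.Unary.Unique.Propositional using (Unique)
  open import Data.List.Relation.Binary.Subset.Propositional using (_⊆_)
  open import Data.List.Membership.Propositional using (_∈_; _∉_; find)
  open import Data.List.Membership.DecPropositional _≟P_ using (_∈?_)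
  open import Data.Product using (_×_; _,_; ∃-syntax)
  open import Data.Sum using (_⊎_; inj₁; inj₂)
  open import Data.Empty using (⊥-elim)
  open import Function using (_∘_)
  open import Relation.Nullary using (¬_; Dec; yes; no)
  open import Relation.Nullary.Decidable using (toWitness; _→-dec_; _⊎-dec_; _×-dec_)
  open import Relation.Binary.PropositionalEquality using (_≡_; trans)

  isPerm? : (σ : Perm4) → Dec (IsPerm σ)
  isPerm? σ = all? λ i → all? λ j → (lookup σ i ≟ lookup σ j) →-dec (i ≟ j)

  perm∈symmetricGroup : ∀ σ → IsPerm σ → σ ∈ symmetricGroup
  perm∈symmetricGroup (a ∷ b ∷ c ∷ d ∷ []) =
    toWitness {a? = all? λ a → all? λ b → all? λ c → all? λ d →
                      isPerm? (a ∷ b ∷ c ∷ d ∷ []) →-dec ((a ∷ b ∷ c ∷ d ∷ []) ∈? symmetricGroup)} _ a b c d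

  nonIntegralGroups : List (List Perm4)
  nonIntegralGroups = dihedral₁ ∷ dihedral₂ ∷ dihedral₃ ∷ alternating ∷ []

  order4Groups : List (List Perm4)
  order4Groups = cyclic₁ ∷ cyclic₂ ∷ cyclic₃ ∷ klein ∷ []

  nonIntegralGroups-witnesses : All NonIntegralityWitness nonIntegralGroups
  nonIntegralGroups-witnesses =
    dihedral₁-witness ∷ dihedral₂-witness ∷ dihedral₃-witness ∷ alternating-witness ∷ []

  -- Opaque, so that the proofs produced by the decision procedures are never unfolded.
  opaque
    nonIntegralGroups-maximal :
      All (λ Y → All (λ r → r ∈ Y ⊎ All (_∈ generate (r ∷ Y)) symmetricGroup) symmetricGroup) nonIntegralGroups
    nonIntegralGroups-maximal = toWitness {a? = All.all? (λ Y → All.all? (λ r →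
      (r ∈? Y) ⊎-dec All.all? (_∈? generate (r ∷ Y)) symmetricGroup) symmetricGroup) nonIntegralGroups} _

    order4Groups-extensions :
      All (λ Q → All (λ r → r ∈ Q ⊎ Any (λ Y → All (_∈ generate (r ∷ Q)) Y) nonIntegralGroups) symmetricGroup)
          order4Groups
    order4Groups-extensions = toWitness {a? = All.all? (λ Q → All.all? (λ r →
      (r ∈? Q) ⊎-dec Any.any? (All.all? (_∈? generate (r ∷ Q))) nonIntegralGroups) symmetricGroup) order4Groups} _

    order4Groups-unique-length4 : All (λ Q → Unique Q × length Q ≡ 4) order4Groups
    order4Groups-unique-length4 = toWitness {a? = All.all? (λ Q → unique? Q ×-dec (length Q ℕ.≟ 4)) order4Groups} _

    transitiveTriples-generate-candidate :
      All (λ a → lookup a 0F ≡ 1F →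
        All (λ b → lookup b 0F ≡ 2F →
          All (λ c → lookup c 0F ≡ 3F →
            Any (λ Y → All (_∈ generate (a ∷ b ∷ c ∷ [])) Y) (nonIntegralGroups ++ order4Groups))
          symmetricGroup) symmetricGroup) symmetricGroup
    transitiveTriples-generate-candidate = toWitness {a? =
      All.all? (λ a → (lookup a 0F ≟ 1F) →-dec
        All.all? (λ b → (lookup b 0F ≟ 2F) →-dec
          All.all? (λ c → (lookup c 0F ≟ 3F) →-dec
            Any.any? (All.all? (_∈? generate (a ∷ b ∷ c ∷ []))) (nonIntegralGroups ++ order4Groups))
          symmetricGroup) symmetricGroup) symmetricGroup} _

  module _ {H : List Perm4} (H-subgroup : Subgroup H) where
    open Subgroup H-subgroup

    H⊆symmetricGroup : H ⊆ symmetricGroup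
    H⊆symmetricGroup σ∈H = perm∈symmetricGroup _ (perms σ∈H)

    ⊆-or-outside : ∀ Y → H ⊆ Y ⊎ ∃[ r ] (r ∈ H × r ∉ Y)
    ⊆-or-outside Y with All.all? (_∈? Y) H
    ... | yes H⊆Y = inj₁ (All.lookup H⊆Y)
    ... | no  H⊈Y = inj₂ (find (¬All⇒Any¬ (_∈? Y) H H⊈Y))

    containsNonIntegral⇒¬cayleyIntegral : Any (λ Y → All (_∈ H) Y) nonIntegralGroups → ¬ CayleyIntegral H
    containsNonIntegral⇒¬cayleyIntegral containsNonIntegral with find containsNonIntegral
    ... | Y , Y∈nonIntegral , Y⊆H with ⊆-or-outside Y
    ...   | inj₁ H⊆Y =
      witness⇒¬cayleyIntegral (All.lookup nonIntegralGroups-witnesses Y∈nonIntegral) unique H⊆Y (All.lookup Y⊆H)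
    ...   | inj₂ (r , r∈H , r∉Y)
      with All.lookup (All.lookup nonIntegralGroups-maximal Y∈nonIntegral) (H⊆symmetricGroup r∈H)
    ...     | inj₁ r∈Y      = λ _ → r∉Y r∈Y
    ...     | inj₂ S₄⊆⟨r,Y⟩ = witness⇒¬cayleyIntegral symmetricGroup-witness unique H⊆symmetricGroup
                               (generate⊆ H-subgroup (r∈H ∷ Y⊆H) ∘ All.lookup S₄⊆⟨r,Y⟩)

    containsOrder4⇒order4 : Any (λ Q → All (_∈ H) Q) order4Groups → CayleyIntegral H → length H ≡ 4
    containsOrder4⇒order4 containsOrder4 integral with find containsOrder4
    ... | Q , Q∈order4 , Q⊆H with ⊆-or-outside Q
    ...   | inj₁ H⊆Q = let Q-unique , |Q|≡4 = All.lookup order4Groups-unique-length4 Q∈order4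
                       in trans (length-sameElements unique Q-unique H⊆Q (All.lookup Q⊆H)) |Q|≡4
    ...   | inj₂ (r , r∈H , r∉Q)
      with All.lookup (All.lookup order4Groups-extensions Q∈order4) (H⊆symmetricGroup r∈H)
    ...     | inj₁ r∈Q         = ⊥-elim (r∉Q r∈Q)
    ...     | inj₂ ⟨r,Q⟩⊇group = ⊥-elim (containsNonIntegral⇒¬cayleyIntegral
                                   (Any.map (All.map (generate⊆ H-subgroup (r∈H ∷ Q⊆H))) ⟨r,Q⟩⊇group) integral)

    transitive⇒containsCandidate : Transitive H → Any (λ Y → All (_∈ H) Y) (nonIntegralGroups ++ order4Groups)
    transitive⇒containsCandidate transitive =
      let a , a∈H , a0≡1 = transitive 0F 1F
          b , b∈H , b0≡2 = transitive 0F 2F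
          c , c∈H , c0≡3 = transitive 0F 3F
          generated = All.lookup (All.lookup (All.lookup transitiveTriples-generate-candidate
                        (H⊆symmetricGroup a∈H) a0≡1) (H⊆symmetricGroup b∈H) b0≡2) (H⊆symmetricGroup c∈H) c0≡3
      in Any.map (All.map (generate⊆ H-subgroup (a∈H ∷ b∈H ∷ c∈H ∷ []))) generated

open Classification
open import Data.List.Relation.Unary.Any.Properties using (++⁻)
open import Data.Sum using (inj₁; inj₂)
open import Data.Empty using (⊥-elim)

corollary4p9 : (H : List Perm4) → Subgroup H → Transitive H → CayleyIntegral H →
    length H ≡ 4
corollary4p9 H H-subgroup H-transitive H-integral
  with ++⁻ nonIntegralGroups (transitive⇒containsCandidate H-subgroup H-transitive)
... | inj₁ containsNonIntegral =
  ⊥-elim (containsNonIntegral⇒¬cayleyIntegral H-subgroup containsNonIntegral H-integral)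
... | inj₂ containsOrder4 =
  containsOrder4⇒order4 H-subgroup containsOrder4 H-integral
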